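{- Let $(A,\to,1)$ be a sectionally j-pseudocomplemented poset such that $A$ is a meet-semilattice (respectively, a lattice). Then $\to$ is a relative pseudocomplementation on $A$ if and only if for all $x,y,z\in A$: if $x\le y$, then $z\to x\le z\to y$.
   Context: A sectionally j-pseudocomplemented poset is an algebra $(A,\to,1)$ where $A$ is a poset with order $\le$ and greatest element $1$ and $\to$ is a binary operation satisfying for all $x,y,z$: (i) if $x\le y\to z$ then $y\le x\to z$; (ii) if $x\le x\to y$ then $x\le y$; (iii) if the meet $x\wedge y$ exists then $x\le y\to(x\wedge y)$. A binary operation $\to$ on $A$ is a relative pseudocomplementation if for all $x,y,u$: (R1) if $u\le x\to y$, then every $v$ with $v\le x$, $v\le u$ satisfies $v\le y$; and (R2) if every $v$ with $v\le x$, $v\le u$ satisfies $v\le y$, then $u\le x\to y$. (In a meet-semilattice this means: $u\le x\to y$ iff $u\wedge x\le y$.) -}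

module Defs where

open import Level using (Level; _⊔_; suc)
open import Data.Product using (Σ; _×_; _,_)
open import Relation.Binary.PropositionalEquality using (_≡_)
open import Relation.Binary.Structures using (IsPartialOrder)

IsMeet : {a ℓ : Level} {A : Set a} → (A → A → Set ℓ) → A → A → A → Set (a ⊔ ℓ)
IsMeet _≤_ x y m = (m ≤ x) × (m ≤ y) × (∀ v → v ≤ x → v ≤ y → v ≤ m)

IsJoin : {a ℓ : Level} {A : Set a} → (A → A → Set ℓ) → A → A → A → Set (a ⊔ ℓ)
IsJoin _≤_ x y j = (x ≤ j) × (y ≤ j) × (∀ v → x ≤ v → y ≤ v → j ≤ v)

IsGreatest : {a ℓ : Level} {A : Set a} → (A → A → Set ℓ) → A → Set (a ⊔ ℓ)
IsGreatest _≤_ t = ∀ x → x ≤ t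

IsMeetSemilatticePoset : {a ℓ : Level} {A : Set a} → (A → A → Set ℓ) → Set (a ⊔ ℓ)
IsMeetSemilatticePoset _≤_ = ∀ x y → Σ _ (IsMeet _≤_ x y)

IsLatticePoset : {a ℓ : Level} {A : Set a} → (A → A → Set ℓ) → Set (a ⊔ ℓ)
IsLatticePoset _≤_ = (∀ x y → Σ _ (IsMeet _≤_ x y)) × (∀ x y → Σ _ (IsJoin _≤_ x y))

record IsSJPPoset {a ℓ : Level} {A : Set a} (_≤_ : A → A → Set ℓ)
                  (_⇒_ : A → A → A) (𝟙 : A) : Set (a ⊔ ℓ) where
  field
    isPartialOrder : IsPartialOrder _≡_ _≤_
    top            : IsGreatest _≤_ 𝟙
    ax-i           : ∀ x y z → x ≤ (y ⇒ z) → y ≤ (x ⇒ z)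
    ax-ii          : ∀ x y → x ≤ (x ⇒ y) → x ≤ y
    ax-iii         : ∀ x y m → IsMeet _≤_ x y m → x ≤ (y ⇒ m)

-- ⇒ is a relative pseudocomplementation (poset form, conditions R1, R2).
IsRelativePseudocomplementation : {a ℓ : Level} {A : Set a} →
  (A → A → Set ℓ) → (A → A → A) → Set (a ⊔ ℓ)
IsRelativePseudocomplementation _≤_ _⇒_ =
  (∀ x y u → u ≤ (x ⇒ y) → ∀ v → v ≤ x → v ≤ u → v ≤ y) ×
  (∀ x y u → (∀ v → v ≤ x → v ≤ u → v ≤ y) → u ≤ (x ⇒ y))

IsRightMonotone : {a ℓ : Level} {A : Set a} →
  (A → A → Set ℓ) → (A → A → A) → Set (a ⊔ ℓ)
IsRightMonotone _≤_ _⇒_ = ∀ x y z → x ≤ y → (z ⇒ x) ≤ (z ⇒ y)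

-- Proof outline.
--  * Condition (R1) holds in EVERY sectionally j-pseudocomplemented poset:
--    from v ≤ x and v ≤ u ≤ x ⇒ y, axiom (i) gives x ≤ v ⇒ y, hence
--    v ≤ v ⇒ y, and axiom (ii) yields v ≤ y.
--  * (R1)+(R2) imply right monotonicity for any preorder: every common
--    lower bound of z and z ⇒ x lies below x ≤ y, so (R2) gives
--    z ⇒ x ≤ z ⇒ y.
--  * Conversely, with meets, (R2) follows from monotonicity: if every common
--    lower bound of x and u lies below y, then u ∧ x ≤ y, and axiom (iii)
--    with monotonicity gives u ≤ x ⇒ (u ∧ x) ≤ x ⇒ y.
-- The lattice case is an instance of the meet-semilattice case.
module Submission where

open import Defs
open import Level using (Level)
open import Data.Product using (_×_; _,_; proj₁)
open import Function.Bundles using (_⇔_; mk⇔)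
open import Relation.Binary.PropositionalEquality using (_≡_)
open import Relation.Binary.Structures using (IsPreorder; IsPartialOrder)

rpc⇒rightMonotone : {a ℓ : Level} {A : Set a} {_≤_ : A → A → Set ℓ} {_⇒_ : A → A → A} →
  IsPreorder _≡_ _≤_ →
  IsRelativePseudocomplementation _≤_ _⇒_ → IsRightMonotone _≤_ _⇒_
rpc⇒rightMonotone {_≤_ = _≤_} {_⇒_} pre (R1 , R2) x y z x≤y =
  R2 z y (z ⇒ x) below-y
  where
    open IsPreorder pre using (trans) renaming (refl to ≤-refl)

    below-y : ∀ v → v ≤ z → v ≤ (z ⇒ x) → v ≤ y
    below-y v v≤z v≤z⇒x = trans (R1 z x (z ⇒ x) ≤-refl v v≤z v≤z⇒x) x≤y

module SJPPoset {a ℓ : Level} {A : Set a} {_≤_ : A → A → Set ℓ} {_⇒_ : A → A → A} {𝟙 : A}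
                (S : IsSJPPoset _≤_ _⇒_ 𝟙) where
  open IsSJPPoset S
  open IsPartialOrder isPartialOrder using (isPreorder; trans)

  r1 : ∀ x y u → u ≤ (x ⇒ y) → ∀ v → v ≤ x → v ≤ u → v ≤ y
  r1 x y u u≤x⇒y v v≤x v≤u = ax-ii v y (trans v≤x x≤v⇒y)
    where
      x≤v⇒y : x ≤ (v ⇒ y)
      x≤v⇒y = ax-i v x y (trans v≤u u≤x⇒y)

  r2 : IsMeetSemilatticePoset _≤_ → IsRightMonotone _≤_ _⇒_ →
       ∀ x y u → (∀ v → v ≤ x → v ≤ u → v ≤ y) → u ≤ (x ⇒ y)
  r2 meets mono x y u lower⇒y with meets u x
  ... | m , isMeet@(m≤u , m≤x , _) =
    trans (ax-iii u x m isMeet) (mono m y x (lower⇒y m m≤x m≤u))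

  rpc⇔rightMonotone : IsMeetSemilatticePoset _≤_ →
    IsRelativePseudocomplementation _≤_ _⇒_ ⇔ IsRightMonotone _≤_ _⇒_
  rpc⇔rightMonotone meets =
    mk⇔ (rpc⇒rightMonotone isPreorder) (λ mono → r1 , r2 meets mono)

theorem3p6 : {a ℓ : Level} {A : Set a} (_≤_ : A → A → Set ℓ) (_⇒_ : A → A → A) (𝟙 : A) →
    IsSJPPoset _≤_ _⇒_ 𝟙 →
    (IsMeetSemilatticePoset _≤_ →
    (IsRelativePseudocomplementation _≤_ _⇒_ ⇔ IsRightMonotone _≤_ _⇒_)) ×
    (IsLatticePoset _≤_ →
    (IsRelativePseudocomplementation _≤_ _⇒_ ⇔ IsRightMonotone _≤_ _⇒_))
theorem3p6 _≤_ _⇒_ 𝟙 S =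
  rpc⇔rightMonotone , (λ lattice → rpc⇔rightMonotone (proj₁ lattice))
  where open SJPPoset S
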